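{- Let $\Pi$ be an STR derivation of $\Gamma\vdash M:\sigma$ and let $N$ be an instance of $M$. Then there is a context $\Delta$ and an STR derivation $\Sigma$ of $\Delta\vdash N:\sigma$ obtained from $\Pi$ by applying a suitable sequence of applications of rule (m).
   Context: Terms: $M ::= x \mid \lambda x.M \mid MM$ modulo $\alpha$-equivalence; $FV(M)$ free variables. A term $N$ is an instance of $M$ if there are $n\ge0$, subsets $X_1,\dots,X_n$ of $FV(M)$ and fresh variables $y_1,\dots,y_n$ such that $N$ is obtained from $M$ by renaming every variable in $X_i$ to $y_i$. STR types: linear $A ::= a \mid \sigma\multimap A \mid \forall a.A$, stratified $\sigma ::= A \mid \{\sigma_1,\dots,\sigma_n\}$ ($n\ge1$), modulo renaming of bound type variables and the congruence treating $\{\sigma_1,\dots,\sigma_n\}$ as a finite set. Contexts are finite partial maps from term variables to types. Rules ($A,B$ linear): (Ax) $x:A\vdash x:A$; (w) from $\Gamma\vdash M:\sigma$, $x\notin dom(\Gamma)$, infer $\Gamma,x:A\vdash M:\sigma$; ($\multimap$I) from $\Gamma,x:\sigma\vdash M:B$ infer $\Gamma\vdash\lambda x.M:\sigma\multimap B$; ($\multimap$E) from $\Gamma_1\vdash M:\sigma\multimap A$, $\Gamma_2\vdash N:\sigma$ with disjoint domains infer $\Gamma_1,\Gamma_2\vdash MN:A$; (m) from $\Gamma,x_1:\sigma_1,\dots,x_n:\sigma_n\vdash M:\tau$ infer $\Gamma,x:\{\sigma_1,\dots,\sigma_n\}\vdash M[x/x_1,\dots,x/x_n]:\tau$; (st)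 from $\Gamma_i\vdash M:\sigma_i$ ($1\le i\le n$), all $\Gamma_i$ with the same domain, infer $\bigcup_i\{\Gamma_i\}\vdash M:\{\sigma_1,\dots,\sigma_n\}$, where $(\bigcup_i\{\Gamma_i\})(x)=\{\Gamma_1(x),\dots,\Gamma_n(x)\}$; ($\forall$I) from $\Gamma\vdash M:A$, $a$ not free in $\Gamma$, infer $\Gamma\vdash M:\forall a.A$; ($\forall$E) from $\Gamma\vdash M:\forall a.B$ infer $\Gamma\vdash M:B[A/a]$, $A$ linear. -}

module Defs where

open import Data.Nat using (ℕ; zero; suc; _≡ᵇ_; _<ᵇ_)
open import Data.Bool using (Bool; true; false; if_then_else_; _∧_; _∨_; not; T)
open import Data.List using (List; []; _∷_; _++_; tabulate)
open import Data.Bool.ListAction using (any)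
open import Data.List.NonEmpty using (List⁺; _∷_; toList)
open import Data.Maybe using (Maybe; just; nothing)
open import Data.Fin using (Fin; zero; suc)
open import Data.Product using (Σ; _×_; _,_)
open import Data.Sum using (_⊎_)
open import Data.List.Relation.Unary.All using (All)
open import Data.List.Relation.Unary.Any using (Any)
open import Data.List.Relation.Unary.Unique.Propositional using (Unique)
open import Data.List.Relation.Binary.Pointwise using (Pointwise)
open import Data.List.Membership.Propositional using (_∈_; _∉_)
open import Relation.Binary.PropositionalEquality using (_≡_)

-- STR types, locally nameless: free type variables  tvar a,
-- bound type variables as de Bruijn indices  tbv i  (so renaming of
-- bound type variables is syntactic identity).

mutual
  data Lin : Set where
    tvar : ℕ → Lin
    tbv  : ℕ → Lin
    _⊸_  : Str → Lin → Lin
    ∀̂    : Lin → Lin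

  data Str : Set where
    lin : Lin → Str
    set : List⁺ Str → Str

infixr 20 _⊸_

mutual
  openL : ℕ → Lin → Lin → Lin
  openL k A (tvar b) = tvar b
  openL k A (tbv i)  = if i ≡ᵇ k then A else tbv i
  openL k A (σ ⊸ B)  = openS k A σ ⊸ openL k A B
  openL k A (∀̂ B)    = ∀̂ (openL (suc k) A B)

  openS : ℕ → Lin → Str → Str
  openS k A (lin B)          = lin (openL k A B)
  openS k A (set (σ ∷ σs))   = set (openS k A σ ∷ openSs k A σs)

  openSs : ℕ → Lin → List Str → List Str
  openSs k A []       = []
  openSs k A (σ ∷ σs) = openS k A σ ∷ openSs k A σs

mutual
  closeL : ℕ → ℕ → Lin → Lin
  closeL k a (tvar b) = if b ≡ᵇ a then tbv k else tvar b
  closeL k a (tbv i)  = tbv i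
  closeL k a (σ ⊸ B)  = closeS k a σ ⊸ closeL k a B
  closeL k a (∀̂ B)    = ∀̂ (closeL (suc k) a B)

  closeS : ℕ → ℕ → Str → Str
  closeS k a (lin B)        = lin (closeL k a B)
  closeS k a (set (σ ∷ σs)) = set (closeS k a σ ∷ closeSs k a σs)

  closeSs : ℕ → ℕ → List Str → List Str
  closeSs k a []       = []
  closeSs k a (σ ∷ σs) = closeS k a σ ∷ closeSs k a σs

mutual
  occL : ℕ → Lin → Bool
  occL a (tvar b) = b ≡ᵇ a
  occL a (tbv i)  = false
  occL a (σ ⊸ B)  = occS a σ ∨ occL a B
  occL a (∀̂ B)    = occL a B

  occS : ℕ → Str → Bool
  occS a (lin B)        = occL a B
  occS a (set (σ ∷ σs)) = occS a σ ∨ occSs a σs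

  occSs : ℕ → List Str → Bool
  occSs a []       = false
  occSs a (σ ∷ σs) = occS a σ ∨ occSs a σs

mutual
  lcL : ℕ → Lin → Bool
  lcL k (tvar b) = true
  lcL k (tbv i)  = i <ᵇ k
  lcL k (σ ⊸ B)  = lcS k σ ∧ lcL k B
  lcL k (∀̂ B)    = lcL (suc k) B

  lcS : ℕ → Str → Bool
  lcS k (lin B)        = lcL k B
  lcS k (set (σ ∷ σs)) = lcS k σ ∧ lcSs k σs

  lcSs : ℕ → List Str → Bool
  lcSs k []       = true
  lcSs k (σ ∷ σs) = lcS k σ ∧ lcSs k σs

LC : Lin → Set
LC A = T (lcL 0 A)

-- The congruence on types: {σ₁,…,σₙ} is a finite set
-- (order and repetitions irrelevant), compatible with all constructors.
mutual
  data _≈L_ : Lin → Lin → Set where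
    tvar≈ : ∀ a → tvar a ≈L tvar a
    tbv≈  : ∀ i → tbv i ≈L tbv i
    ⊸≈    : ∀ {σ σ' A A'} → σ ≈S σ' → A ≈L A' → (σ ⊸ A) ≈L (σ' ⊸ A')
    ∀≈    : ∀ {A A'} → A ≈L A' → ∀̂ A ≈L ∀̂ A'

  data _≈S_ : Str → Str → Set where
    lin≈ : ∀ {A A'} → A ≈L A' → lin A ≈S lin A'
    set≈ : ∀ {σs τs : List⁺ Str} →
           All (λ σ → Any (λ τ → σ ≈S τ) (toList τs)) (toList σs) →
           All (λ τ → Any (λ σ → σ ≈S τ) (toList σs)) (toList τs) →
           set σs ≈S set τs

-- λ-terms modulo α, locally nameless: free variables  var x,
-- bound variables as de Bruijn indices  bv i.

data Term : Set where
  var : ℕ → Term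
  bv  : ℕ → Term
  lam : Term → Term
  app : Term → Term → Term

-- abstract the free variable x at level k  (λx.M  =  lam (closeTm 0 x M))
closeTm : ℕ → ℕ → Term → Term
closeTm k x (var y)   = if y ≡ᵇ x then bv k else var y
closeTm k x (bv i)    = bv i
closeTm k x (lam M)   = lam (closeTm (suc k) x M)
closeTm k x (app M N) = app (closeTm k x M) (closeTm k x N)

FV : Term → List ℕ
FV (var x)   = x ∷ []
FV (bv i)    = []
FV (lam M)   = FV M
FV (app M N) = FV M ++ FV N

rename : (ℕ → ℕ) → Term → Term
rename ρ (var x)   = var (ρ x)
rename ρ (bv i)    = bv i
rename ρ (lam M)   = lam (rename ρ M)
rename ρ (app M N) = app (rename ρ M) (rename ρ N)

_∈ᵇ_ : ℕ → List ℕ → Bool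
v ∈ᵇ xs = any (λ y → v ≡ᵇ y) xs

merge : List ℕ → ℕ → ℕ → ℕ
merge xs x v = if v ∈ᵇ xs then x else v

Ctx : Set
Ctx = ℕ → Maybe Str

[_↦_] : ℕ → Str → Ctx
[ x ↦ σ ] y = if y ≡ᵇ x then just σ else nothing

ext : Ctx → ℕ → Str → Ctx
ext Γ x σ y = if y ≡ᵇ x then just σ else Γ y

_∖_ : Ctx → ℕ → Ctx
(Γ ∖ x) y = if y ≡ᵇ x then nothing else Γ y

_∖∖_ : Ctx → List ℕ → Ctx
(Γ ∖∖ xs) y = if y ∈ᵇ xs then nothing else Γ y

_∪_ : Ctx → Ctx → Ctx
(Γ₁ ∪ Γ₂) y with Γ₁ y
... | just σ  = just σ
... | nothing = Γ₂ y

Disjoint : Ctx → Ctx → Set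
Disjoint Γ₁ Γ₂ = ∀ y → Γ₁ y ≡ nothing ⊎ Γ₂ y ≡ nothing

SameDom : ∀ {n} → (Fin n → Ctx) → Set
SameDom Γs = ∀ i j y → Γs i y ≡ nothing → Γs j y ≡ nothing

NotFreeCtx : ℕ → Ctx → Set
NotFreeCtx a Γ = ∀ y σ → Γ y ≡ just σ → T (not (occS a σ))

tab⁺ : ∀ {A : Set} {n} → (Fin (suc n) → A) → List⁺ A
tab⁺ f = f zero ∷ tabulate (λ i → f (suc i))

allJust : ∀ {A : Set} {k} → (Fin k → Maybe A) → Maybe (Fin k → A)
allJust {k = zero}  f = just (λ ())
allJust {k = suc k} f with f zero | allJust (λ i → f (suc i))
... | just a  | just g = just (λ { zero → a ; (suc i) → g i })
... | _       | _      = nothing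

stCtx : ∀ {n} → (Fin (suc n) → Ctx) → Ctx
stCtx Γs y with allJust (λ i → Γs i y)
... | just f  = just (set (tab⁺ f))
... | nothing = nothing

infix 4 _⊢_∶_

data _⊢_∶_ : Ctx → Term → Str → Set where
  ax : ∀ x A → LC A → [ x ↦ lin A ] ⊢ var x ∶ lin A
  w  : ∀ {Γ M σ} x A → LC A → Γ x ≡ nothing →
       Γ ⊢ M ∶ σ → ext Γ x (lin A) ⊢ M ∶ σ
  ⊸I : ∀ {Γ M σ B} x → Γ x ≡ just σ →
       Γ ⊢ M ∶ lin B → (Γ ∖ x) ⊢ lam (closeTm 0 x M) ∶ lin (σ ⊸ B)
  -- types are taken modulo ≈, which only matters where two types meet
  ⊸E : ∀ {Γ₁ Γ₂ M N σ σ' A} →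
       Γ₁ ⊢ M ∶ lin (σ ⊸ A) → Γ₂ ⊢ N ∶ σ' → σ ≈S σ' → Disjoint Γ₁ Γ₂ →
       (Γ₁ ∪ Γ₂) ⊢ app M N ∶ lin A
  -- (m): premise context Γ = Γ', x₁:σ₁,…,xₙ:σₙ with Γ' = Γ ∖∖ xs
  m  : ∀ {Γ M τ} (xs : List⁺ ℕ) (σs : List⁺ Str) (x : ℕ) →
       Pointwise (λ y σ → Γ y ≡ just σ) (toList xs) (toList σs) →
       Unique (toList xs) →
       (Γ ∖∖ toList xs) x ≡ nothing →
       Γ ⊢ M ∶ τ →
       ext (Γ ∖∖ toList xs) x (set σs) ⊢ rename (merge (toList xs) x) M ∶ τ
  st : ∀ {n M} (Γs : Fin (suc n) → Ctx) (σs : Fin (suc n) → Str) →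
       (∀ i → Γs i ⊢ M ∶ σs i) → SameDom Γs →
       stCtx Γs ⊢ M ∶ set (tab⁺ σs)
  ∀I : ∀ {Γ M A} a → NotFreeCtx a Γ →
       Γ ⊢ M ∶ lin A → Γ ⊢ M ∶ lin (∀̂ (closeL 0 a A))
  ∀E : ∀ {Γ M B} A → LC A →
       Γ ⊢ M ∶ lin (∀̂ B) → Γ ⊢ M ∶ lin (openL 0 A B)

data _⇝m*_ : ∀ {Γ Δ M N σ} → Γ ⊢ M ∶ σ → Δ ⊢ N ∶ σ → Set where
  done : ∀ {Γ M σ} {Π : Γ ⊢ M ∶ σ} → Π ⇝m* Π
  step : ∀ {Γ Δ M N τ} {Π : Γ ⊢ M ∶ τ} {Σ' : Δ ⊢ N ∶ τ}
         (xs : List⁺ ℕ) (σs : List⁺ Str) (x : ℕ)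
         (p : Pointwise (λ y σ → Γ y ≡ just σ) (toList xs) (toList σs))
         (u : Unique (toList xs))
         (fr : (Γ ∖∖ toList xs) x ≡ nothing) →
         m xs σs x p u fr Π ⇝m* Σ' → Π ⇝m* Σ'

instRen : ∀ n → (Fin n → List ℕ) → (Fin n → ℕ) → ℕ → ℕ
instRen zero    X y v = v
instRen (suc n) X y v =
  if v ∈ᵇ X zero then y zero else instRen n (λ i → X (suc i)) (λ i → y (suc i)) v

record Instance (N M : Term) : Set where
  field
    n        : ℕ
    X        : Fin n → List ℕ
    y        : Fin n → ℕ
    X⊆FV     : ∀ i → All (_∈ FV M) (X i)
    disjoint : ∀ i j v → v ∈ X i → v ∈ X j → i ≡ j
    fresh    : ∀ i → y i ∉ FV M
    distinct : ∀ i j → y i ≡ y j → i ≡ j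
    isRen    : N ≡ rename (instRen n X y) M

module Submission where

-- An instance N of M renames, for each i < n, the variables of a group
-- Xᵢ ⊆ FV(M) to a fresh variable yᵢ; we treat the groups one at a time.
-- A single group X ↦ y costs at most one application of (m) to the
-- derivation Π of Γ ⊢ M : σ: merge into y the variables of y ∷ X bound in Γ.
-- Every x ∈ X is bound, since FV(M) ⊆ dom Γ; y itself may be bound through
-- weakening and is merged too, so that y is fresh for the new context.  If
-- no variable is selected, X is empty and nothing is to be done.  After
-- group 0 the remaining groups are an instance of the renamed term, and the
-- successive one-group renamings compose to the renaming of the instance.

open import Defs
open import Data.Nat using (ℕ; zero; suc; _≡ᵇ_; _≟_)
open import Data.Nat.Properties using (≡ᵇ⇒≡; ≡⇒≡ᵇ)
open import Data.Bool using (true; false; T; T?)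
open import Data.Maybe using (Maybe; just; nothing; is-just)
open import Data.Fin using (Fin; zero; suc)
open import Data.Fin.Properties using (suc-injective; 0≢1+n)
open import Data.List using (List; []; _∷_; _++_; map; filter; deduplicate)
open import Data.List.NonEmpty using (_∷_; toList)
open import Data.Product using (Σ-syntax; ∃; _×_; _,_; -,_; proj₁; proj₂)
open import Data.Sum using (inj₁; inj₂)
open import Data.Empty using (⊥-elim)
open import Function using (_∘_)
open import Data.List.Relation.Unary.All as All using (All; []; _∷_)
open import Data.List.Relation.Unary.Any as Any using (here; there)
open import Data.List.Relation.Unary.Any.Properties using (any⁺; any⁻)
open import Data.List.Relation.Unary.Unique.Propositional using (Unique)
open import Data.List.Relation.Unary.Unique.DecPropositional.Properties _≟_
  using (deduplicate-!)
open import Data.List.Relation.Binary.Pointwise using (Pointwise; []; _∷_)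
open import Data.List.Membership.Propositional using (_∈_; _∉_)
open import Data.List.Membership.DecPropositional _≟_ using (_∈?_)
open import Data.List.Membership.Propositional.Properties
  using (∈-map⁺; ∈-map⁻; ∈-++⁺ˡ; ∈-++⁺ʳ; ∈-++⁻; ∈-filter⁺; ∈-filter⁻;
         ∈-deduplicate⁺; ∈-deduplicate⁻)
open import Data.List.Properties using (map-++)
open import Relation.Binary.PropositionalEquality
open import Relation.Nullary using (yes; no)
open import Relation.Unary using (Decidable)
open import Relation.Nullary.Reflects using (Reflects; ofʸ; ofⁿ; fromEquivalence)

≡ᵇ-reflects : ∀ a b → Reflects (a ≡ b) (a ≡ᵇ b)
≡ᵇ-reflects a b = fromEquivalence (≡ᵇ⇒≡ a b) (≡⇒≡ᵇ a b)

∈ᵇ-reflects : ∀ v xs → Reflects (v ∈ xs) (v ∈ᵇ xs)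
∈ᵇ-reflects v xs =
  fromEquivalence (Any.map (≡ᵇ⇒≡ v _) ∘ any⁻ _ xs) (any⁺ _ ∘ Any.map (≡⇒≡ᵇ v _))

merge-hits : ∀ K x {u} → u ∈ K → merge K x u ≡ x
merge-hits K x {u} u∈K with u ∈ᵇ K | ∈ᵇ-reflects u K
... | true  | _       = refl
... | false | ofⁿ u∉K = ⊥-elim (u∉K u∈K)

merge-fixes : ∀ K x {u} → u ∉ K → merge K x u ≡ u
merge-fixes K x {u} u∉K with u ∈ᵇ K | ∈ᵇ-reflects u K
... | true  | ofʸ u∈K = ⊥-elim (u∉K u∈K)
... | false | _       = refl

merge-cong : ∀ K X y {v} → (v ∈ K → v ∈ X) → (v ∈ X → v ∈ K) →
             merge K y v ≡ merge X y v
merge-cong K X y {v} K⊆X X⊆K with v ∈? K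
... | yes v∈K = trans (merge-hits K y v∈K) (sym (merge-hits X y (K⊆X v∈K)))
... | no  v∉K = trans (merge-fixes K y v∉K) (sym (merge-fixes X y (v∉K ∘ X⊆K)))

rename-comp : ∀ f g M → rename f (rename g M) ≡ rename (f ∘ g) M
rename-comp f g (var x)   = refl
rename-comp f g (bv i)    = refl
rename-comp f g (lam M)   = cong lam (rename-comp f g M)
rename-comp f g (app M N) = cong₂ app (rename-comp f g M) (rename-comp f g N)

rename-cong : ∀ {f g} M → (∀ {v} → v ∈ FV M → f v ≡ g v) → rename f M ≡ rename g M
rename-cong (var x)   f≗g = cong var (f≗g (here refl))
rename-cong (bv i)    f≗g = refl
rename-cong (lam M)   f≗g = cong lam (rename-cong M f≗g)
rename-cong (app M N) f≗g =
  cong₂ app (rename-cong M (f≗g ∘ ∈-++⁺ˡ)) (rename-cong N (f≗g ∘ ∈-++⁺ʳ (FV M)))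

rename-id : ∀ M → rename (λ v → v) M ≡ M
rename-id (var x)   = refl
rename-id (bv i)    = refl
rename-id (lam M)   = cong lam (rename-id M)
rename-id (app M N) = cong₂ app (rename-id M) (rename-id N)

FV-rename : ∀ ρ M → FV (rename ρ M) ≡ map ρ (FV M)
FV-rename ρ (var x)   = refl
FV-rename ρ (bv i)    = refl
FV-rename ρ (lam M)   = FV-rename ρ M
FV-rename ρ (app M N) =
  trans (cong₂ _++_ (FV-rename ρ M) (FV-rename ρ N)) (sym (map-++ ρ (FV M) (FV N)))

FV-rename⁺ : ∀ ρ M {u} → u ∈ FV M → ρ u ∈ FV (rename ρ M)
FV-rename⁺ ρ M u∈M = subst (_ ∈_) (sym (FV-rename ρ M)) (∈-map⁺ ρ u∈M)

FV-rename⁻ : ∀ ρ M {v} → v ∈ FV (rename ρ M) → ∃ λ u → u ∈ FV M × v ≡ ρ u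
FV-rename⁻ ρ M v∈ρM = ∈-map⁻ ρ (subst (_ ∈_) (FV-rename ρ M) v∈ρM)

FV-close : ∀ k x M {v} → v ∈ FV (closeTm k x M) → v ∈ FV M × v ≢ x
FV-close k x (var y) p with y ≡ᵇ x | ≡ᵇ-reflects y x
FV-close k x (var y) ()          | true  | _
FV-close k x (var y) (here refl) | false | ofⁿ y≢x = here refl , y≢x
FV-close k x (lam M) p = FV-close (suc k) x M p
FV-close k x (app M N) p with ∈-++⁻ (FV (closeTm k x M)) p
... | inj₁ q = let (v∈M , v≢x) = FV-close k x M q in ∈-++⁺ˡ v∈M , v≢x
... | inj₂ q = let (v∈N , v≢x) = FV-close k x N q in ∈-++⁺ʳ (FV M) v∈N , v≢x

ext-nothing : ∀ Γ x σ {v} → ext Γ x σ v ≡ nothing → v ≢ x × Γ v ≡ nothing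
ext-nothing Γ x σ {v} e with v ≡ᵇ x | ≡ᵇ-reflects v x
ext-nothing Γ x σ ()    | true  | _
ext-nothing Γ x σ e     | false | ofⁿ v≢x = v≢x , e

remove-nothing : ∀ Γ x {v} → (Γ ∖ x) v ≡ nothing → v ≢ x → Γ v ≡ nothing
remove-nothing Γ x {v} e v≢x with v ≡ᵇ x | ≡ᵇ-reflects v x
... | true  | ofʸ v≡x = ⊥-elim (v≢x v≡x)
... | false | _       = e

removeAll-nothing : ∀ Γ K {v} → (Γ ∖∖ K) v ≡ nothing → v ∉ K → Γ v ≡ nothing
removeAll-nothing Γ K {v} e v∉K with v ∈ᵇ K | ∈ᵇ-reflects v K
... | true  | ofʸ v∈K = ⊥-elim (v∉K v∈K)
... | false | _       = e

removeAll-unbinds : ∀ Γ K {v} → (Γ v ≢ nothing → v ∈ K) → (Γ ∖∖ K) v ≡ nothing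
removeAll-unbinds Γ K {v} bound⇒∈ with v ∈ᵇ K | ∈ᵇ-reflects v K
... | true  | _       = refl
... | false | ofⁿ v∉K with Γ v
...   | nothing = refl
...   | just σ  = ⊥-elim (v∉K (bound⇒∈ λ ()))

∪-nothing : ∀ Γ₁ Γ₂ {v} → (Γ₁ ∪ Γ₂) v ≡ nothing → Γ₁ v ≡ nothing × Γ₂ v ≡ nothing
∪-nothing Γ₁ Γ₂ {v} e with Γ₁ v
... | nothing = refl , e

allJust-nothing : ∀ {A : Set} {k} (f : Fin k → Maybe A) →
                  allJust f ≡ nothing → ∃ λ i → f i ≡ nothing
allJust-nothing {k = suc k} f e with f zero in f0 | allJust (f ∘ suc) in rest
... | nothing | _      = zero , f0
... | just _  | nothing = let (i , fi) = allJust-nothing (f ∘ suc) rest in suc i , fi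

stCtx-nothing : ∀ {n} (Γs : Fin (suc n) → Ctx) {v} →
                stCtx Γs v ≡ nothing → ∃ λ i → Γs i v ≡ nothing
stCtx-nothing Γs {v} e with allJust (λ i → Γs i v) in all
... | nothing = allJust-nothing (λ i → Γs i v) all

FV⊆dom : ∀ {Γ M σ} → Γ ⊢ M ∶ σ → ∀ {v} → v ∈ FV M → Γ v ≢ nothing
FV⊆dom (ax x A _) (here refl) e = proj₁ (ext-nothing (λ _ → nothing) x (lin A) e) refl
FV⊆dom (w {Γ} x A _ _ d) p e = FV⊆dom d p (proj₂ (ext-nothing Γ x (lin A) e))
FV⊆dom (⊸I {Γ} {M} x _ d) p e =
  let (v∈M , v≢x) = FV-close 0 x M p in FV⊆dom d v∈M (remove-nothing Γ x e v≢x)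
FV⊆dom (⊸E {Γ₁} {Γ₂} {M} d₁ d₂ _ _) p e with ∈-++⁻ (FV M) p
... | inj₁ q = FV⊆dom d₁ q (proj₁ (∪-nothing Γ₁ Γ₂ e))
... | inj₂ q = FV⊆dom d₂ q (proj₂ (∪-nothing Γ₁ Γ₂ e))
FV⊆dom (m {Γ} {M} xs σs x _ _ _ d) p e
  with FV-rename⁻ (merge (toList xs) x) M p
... | u , u∈M , refl with ext-nothing (Γ ∖∖ toList xs) x (set σs) e | u ∈? toList xs
...   | merged≢x , _ | yes u∈xs = merged≢x (merge-hits (toList xs) x u∈xs)
...   | _ , removed  | no u∉xs  =
  FV⊆dom d u∈M (removeAll-nothing Γ (toList xs)
                  (subst (λ z → (Γ ∖∖ toList xs) z ≡ nothing)
                         (merge-fixes (toList xs) x u∉xs) removed) u∉xs)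
FV⊆dom (st Γs σs ds sameDom) p e =
  let (i , unbound) = stCtx-nothing Γs e in FV⊆dom (ds zero) p (sameDom i zero _ unbound)
FV⊆dom (∀I a _ d) = FV⊆dom d
FV⊆dom (∀E A _ d) = FV⊆dom d

-- The variables of L bound in Γ, without repetitions and with their types:
-- the data of one application of rule (m) to these variables.
record BoundPart (Γ : Ctx) (L : List ℕ) : Set where
  field
    vars     : List ℕ
    types    : List Str
    typed    : Pointwise (λ v σ → Γ v ≡ just σ) vars types
    unique   : Unique vars
    sound    : ∀ {v} → v ∈ vars → v ∈ L
    complete : ∀ {v} → v ∈ L → Γ v ≢ nothing → v ∈ vars

typesOf : (Γ : Ctx) (K : List ℕ) → All (λ v → T (is-just (Γ v))) K →
          Σ[ τs ∈ List Str ] Pointwise (λ v σ → Γ v ≡ just σ) K τs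
typesOf Γ []      []       = [] , []
typesOf Γ (v ∷ K) (b ∷ bs) with Γ v in Γv
... | just σ  = let (τs , typed) = typesOf Γ K bs in σ ∷ τs , Γv ∷ typed
... | nothing = ⊥-elim b

is-just⁺ : ∀ {A : Set} (a : Maybe A) → a ≢ nothing → T (is-just a)
is-just⁺ (just _) _       = _
is-just⁺ nothing  a≢nothing = a≢nothing refl

boundPart : ∀ Γ L → BoundPart Γ L
boundPart Γ L = record
  { vars     = K
  ; types    = proj₁ τs
  ; typed    = proj₂ τs
  ; unique   = deduplicate-! bound
  ; sound    = proj₁ ∘ inBound
  ; complete = λ v∈L v-bound → ∈-deduplicate⁺ _≟_ (∈-filter⁺ bound? v∈L (is-just⁺ _ v-bound))
  }
  where
  bound? : Decidable (λ v → T (is-just (Γ v)))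
  bound? v = T? (is-just (Γ v))
  bound : List ℕ
  bound = filter bound? L
  K : List ℕ
  K = deduplicate _≟_ bound
  inBound : ∀ {v} → v ∈ K → v ∈ L × T (is-just (Γ v))
  inBound = ∈-filter⁻ bound? ∘ ∈-deduplicate⁻ _≟_ bound
  τs : Σ[ τs ∈ List Str ] Pointwise (λ v σ → Γ v ≡ just σ) K τs
  τs = typesOf Γ K (All.tabulate (proj₂ ∘ inBound))

Reach : ∀ {Γ M σ} → Γ ⊢ M ∶ σ → Term → Set
Reach {σ = σ} Π N = Σ[ Δ ∈ Ctx ] Σ[ Σ' ∈ Δ ⊢ N ∶ σ ] (Π ⇝m* Σ')

⇝m*-trans : ∀ {Γ₁ Γ₂ Γ₃ M₁ M₂ M₃ σ} {Π₁ : Γ₁ ⊢ M₁ ∶ σ} {Π₂ : Γ₂ ⊢ M₂ ∶ σ}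
            {Π₃ : Γ₃ ⊢ M₃ ∶ σ} → Π₁ ⇝m* Π₂ → Π₂ ⇝m* Π₃ → Π₁ ⇝m* Π₃
⇝m*-trans done                    q = q
⇝m*-trans (step xs σs x p u fr r) q = step xs σs x p u fr (⇝m*-trans r q)

mergeGroup : ∀ {Γ M σ} (Π : Γ ⊢ M ∶ σ) X y → All (_∈ FV M) X → y ∉ FV M →
             Reach Π (rename (merge X y) M)
mergeGroup {Γ} {M} Π X y X⊆M y∉M =
  subst (Reach Π) (rename-cong M agree) (applyM vars types typed unique fresh)
  where
  open BoundPart (boundPart Γ (y ∷ X))

  fresh : (Γ ∖∖ vars) y ≡ nothing
  fresh = removeAll-unbinds Γ vars (complete (here refl))

  -- on FV(M) the selected variables are exactly those of X
  agree : ∀ {v} → v ∈ FV M → merge vars y v ≡ merge X y v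
  agree {v} v∈M = merge-cong vars X y vars⊆X (λ v∈X → complete (there v∈X) (FV⊆dom Π v∈M))
    where
    vars⊆X : v ∈ vars → v ∈ X
    vars⊆X v∈vars with sound v∈vars
    ... | here refl = ⊥-elim (y∉M v∈M)
    ... | there v∈X = v∈X

  applyM : ∀ K τs → Pointwise (λ v σ → Γ v ≡ just σ) K τs → Unique K →
           (Γ ∖∖ K) y ≡ nothing → Reach Π (rename (merge K y) M)
  applyM []      []       []       _ _  = subst (Reach Π) (sym (rename-id M)) (-, Π , done)
  applyM (a ∷ K) (τ ∷ τs) typedK uK fr =
    -, m (a ∷ K) (τ ∷ τs) y typedK uK fr Π , step (a ∷ K) (τ ∷ τs) y typedK uK fr done

record Groups (M : Term) (n : ℕ) (X : Fin n → List ℕ) (y : Fin n → ℕ) : Set where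
  field
    X⊆FV     : ∀ i → All (_∈ FV M) (X i)
    disjoint : ∀ i j v → v ∈ X i → v ∈ X j → i ≡ j
    fresh    : ∀ i → y i ∉ FV M
    distinct : ∀ i j → y i ≡ y j → i ≡ j

groups-tail : ∀ {M n X y} → Groups M (suc n) X y →
              Groups (rename (merge (X zero) (y zero)) M) n (X ∘ suc) (y ∘ suc)
groups-tail {M} {n} {X} {y} g = record
  { X⊆FV     = λ i → All.tabulate (stays i)
  ; disjoint = λ i j v p q → suc-injective (disjoint (suc i) (suc j) v p q)
  ; fresh    = still-fresh
  ; distinct = λ i j e → suc-injective (distinct (suc i) (suc j) e)
  }
  where
  open Groups g
  ρ : ℕ → ℕ
  ρ = merge (X zero) (y zero)

  stays : ∀ i {v} → v ∈ X (suc i) → v ∈ FV (rename ρ M)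
  stays i {v} p = subst (_∈ FV (rename ρ M)) (merge-fixes (X zero) (y zero) v∉X₀)
                        (FV-rename⁺ ρ M (All.lookup (X⊆FV (suc i)) p))
    where
    v∉X₀ : v ∉ X zero
    v∉X₀ q = 0≢1+n (disjoint zero (suc i) v q p)

  still-fresh : ∀ i → y (suc i) ∉ FV (rename ρ M)
  still-fresh i p with FV-rename⁻ ρ M p
  ... | u , u∈M , yᵢ≡ρu with u ∈? X zero
  ...   | yes u∈X₀ = 0≢1+n (sym (distinct (suc i) zero
                                 (trans yᵢ≡ρu (merge-hits (X zero) (y zero) u∈X₀))))
  ...   | no u∉X₀  = fresh (suc i) (subst (_∈ FV M)
                                 (sym (trans yᵢ≡ρu (merge-fixes (X zero) (y zero) u∉X₀))) u∈M)

instRen-out : ∀ n X y {v} → (∀ i → v ∉ X i) → instRen n X y v ≡ v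
instRen-out zero    X y v∉ = refl
instRen-out (suc n) X y {v} v∉ with v ∈ᵇ X zero | ∈ᵇ-reflects v (X zero)
... | true  | ofʸ v∈X₀ = ⊥-elim (v∉ zero v∈X₀)
... | false | _        = instRen-out n (X ∘ suc) (y ∘ suc) (v∉ ∘ suc)

instRen-suc : ∀ n X y → (∀ i → y zero ∉ X (suc i)) → ∀ v →
              instRen (suc n) X y v ≡ instRen n (X ∘ suc) (y ∘ suc) (merge (X zero) (y zero) v)
instRen-suc n X y y₀∉ v with v ∈ᵇ X zero
... | true  = sym (instRen-out n (X ∘ suc) (y ∘ suc) y₀∉)
... | false = refl

renameGroups : ∀ n X y {Γ M σ} (Π : Γ ⊢ M ∶ σ) → Groups M n X y →
               Reach Π (rename (instRen n X y) M)
renameGroups zero X y {M = M} Π g = subst (Reach Π) (sym (rename-id M)) (-, Π , done)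
renameGroups (suc n) X y {M = M} Π g
  with mergeGroup Π (X zero) (y zero) (Groups.X⊆FV g zero) (Groups.fresh g zero)
... | _ , Σ₁ , Π⇝Σ₁ with renameGroups n (X ∘ suc) (y ∘ suc) Σ₁ (groups-tail g)
...   | Δ , Σ' , Σ₁⇝Σ' = subst (Reach Π) composite (Δ , Σ' , ⇝m*-trans Π⇝Σ₁ Σ₁⇝Σ')
  where
  open Groups g
  open ≡-Reasoning
  ρ : ℕ → ℕ
  ρ = merge (X zero) (y zero)
  y₀∉ : ∀ i → y zero ∉ X (suc i)
  y₀∉ i p = fresh zero (All.lookup (X⊆FV (suc i)) p)
  composite : rename (instRen n (X ∘ suc) (y ∘ suc)) (rename ρ M) ≡ rename (instRen (suc n) X y) M
  composite = begin
    rename (instRen n (X ∘ suc) (y ∘ suc)) (rename ρ M) ≡⟨ rename-comp _ ρ M ⟩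
    rename (instRen n (X ∘ suc) (y ∘ suc) ∘ ρ) M         ≡⟨ rename-cong M (λ _ → sym (instRen-suc n X y y₀∉ _)) ⟩
    rename (instRen (suc n) X y) M                      ∎

mainTheorem15 : ∀ {Γ M σ} (Π : Γ ⊢ M ∶ σ) (N : Term) → Instance N M →
                  Σ[ Δ ∈ Ctx ] Σ[ Σ' ∈ Δ ⊢ N ∶ σ ] (Π ⇝m* Σ')
mainTheorem15 Π N inst =
  subst (Reach Π) (sym isRen)
        (renameGroups n X y Π (record { X⊆FV = X⊆FV ; disjoint = disjoint
                                      ; fresh = fresh ; distinct = distinct }))
  where open Instance inst
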